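{- Let $G=(V,E)$ be a finite graph and let $u,v\in V$ be adjacent, with $d_u\geq 2$ or $d_v\geq 2$. Then $$r_{uv}\geq\max\left\{\frac{d_v+d_u-2}{d_ud_v-1},\ \frac{4}{d_u+d_v+2}\right\}.$$
   Context: $d_w$ denotes the degree of vertex $w$. For a finite graph with Laplacian $\mathbf{L}=\mathbf{D}-\mathbf{A}$ (degree matrix minus adjacency matrix) and Moore--Penrose pseudoinverse $\mathbf{L}^\dagger$, the effective resistance is $r_{uv}=(\mathbf{1}_u-\mathbf{1}_v)^\top\mathbf{L}^\dagger(\mathbf{1}_u-\mathbf{1}_v)$, where $\mathbf{1}_u$ is the indicator vector of $u$. -}

module Defs where

open import Data.Nat using (ℕ; zero; suc)
open import Data.Integer using (+_)
open import Data.Fin using (Fin; zero; suc)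
open import Data.Fin.Properties using (_≟_)
open import Data.Bool using (Bool; true; false; if_then_else_)
open import Data.Rational using (ℚ; 0ℚ; 1ℚ; _+_; _*_; _-_; _/_)
open import Relation.Nullary using (does)
open import Relation.Binary.PropositionalEquality using (_≡_)

record SimpleGraph (n : ℕ) : Set where
  field
    adj       : Fin n → Fin n → Bool
    symmetric : ∀ i j → adj i j ≡ adj j i
    loopless  : ∀ i → adj i i ≡ false
open SimpleGraph public

Σℚ : ∀ {n} → (Fin n → ℚ) → ℚ
Σℚ {zero}  f = 0ℚ
Σℚ {suc n} f = f zero + Σℚ (λ i → f (suc i))

Σℕ : ∀ {n} → (Fin n → ℕ) → ℕ
Σℕ {zero}  f = 0
Σℕ {suc n} f = f zero Data.Nat.+ Σℕ (λ i → f (suc i))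

boolℕ : Bool → ℕ
boolℕ true  = 1
boolℕ false = 0

boolℚ : Bool → ℚ
boolℚ true  = 1ℚ
boolℚ false = 0ℚ

degree : ∀ {n} → SimpleGraph n → Fin n → ℕ
degree G w = Σℕ (λ x → boolℕ (adj G w x))

ℕ→ℚ : ℕ → ℚ
ℕ→ℚ k = (+ k) / 1

Matrix : ℕ → Set
Matrix n = Fin n → Fin n → ℚ

laplacian : ∀ {n} → SimpleGraph n → Matrix n
laplacian G i j =
  (if does (i ≟ j) then ℕ→ℚ (degree G i) else 0ℚ) - boolℚ (adj G i j)

_·_ : ∀ {n} → Matrix n → Matrix n → Matrix n
(M · N) i j = Σℚ (λ k → M i k * N k j)

transpose : ∀ {n} → Matrix n → Matrix n
transpose M i j = M j i

IsPseudoInverse : ∀ {n} → Matrix n → Matrix n → Set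
IsPseudoInverse L M =
  (∀ i j → ((L · M) · L) i j ≡ L i j) ×′
  ((∀ i j → ((M · L) · M) i j ≡ M i j) ×′
  ((∀ i j → transpose (L · M) i j ≡ (L · M) i j) ×′
   (∀ i j → transpose (M · L) i j ≡ (M · L) i j)))
  where open import Data.Product using () renaming (_×_ to _×′_)

indicator : ∀ {n} → Fin n → Fin n → ℚ
indicator w x = if does (w ≟ x) then 1ℚ else 0ℚ

effRes : ∀ {n} → Matrix n → Fin n → Fin n → ℚ
effRes M u v =
  Σℚ (λ i → Σℚ (λ j → b i * M i j * b j))
  where b = λ x → indicator u x - indicator v x

-- p / q for naturals; only used with q > 0 (value 0 when q = 0)
_÷ℕ_ : ℕ → ℕ → ℚ
p ÷ℕ zero  = 0ℚ
p ÷ℕ suc q = (+ p) / suc q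

-- Put b = 1_u - 1_v and z_k = M_uk - M_vk, so that r_uv = ⟨ z , b ⟩. Since 2⟨ y , L y ⟩ is
-- the sum of (y_i - y_j)² over ordered adjacent pairs, vectors in the kernel of L take equal
-- values at the two ends of an edge; applied to the columns of I - M L (which L M L = L puts
-- in the kernel) this gives L z = b. As L is symmetric and positive semidefinite,
-- 0 ≤ ⟨ z - x , L (z - x) ⟩ = r_uv - (2⟨ x , b ⟩ - ⟨ x , L x ⟩) for every x. For
-- x = p 1_u - q 1_v this says r_uv ≥ 2(p + q) - (p² d_u + 2pq + q² d_v), and the choices
-- (p, q) = (d_v - 1, d_u - 1) / (d_u d_v - 1) and p = q = 2 / (d_u + d_v + 2) give the two
-- terms of the maximum.

module Submission where

open import Defs
open import Data.Nat using (ℕ; _≥_; _∸_)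
open import Data.Fin using (Fin)
open import Data.Bool using (true)
open import Data.Sum using (_⊎_)
open import Relation.Binary.PropositionalEquality using (_≡_)
open import Data.Rational using (_≤_; _⊔_)

open import Function using (_∘_)
open import Data.Nat as ℕ using (zero; suc)
import Data.Nat.Properties as ℕ
import Data.Nat.Coprimality as Coprime
import Data.Integer as ℤ
import Data.Integer.Properties as ℤ
open import Data.Fin using (zero; suc)
open import Data.Fin.Properties using (_≟_)
open import Data.Bool using (false; if_then_else_)
open import Data.Sum using (inj₁; inj₂)
open import Data.Product using (_,_)
open import Data.Vec.Functional using (Vector)
open import Data.Rational
  using (ℚ; mkℚ; 0ℚ; 1ℚ; _+_; _*_; _-_; -_; 1/_; _<_; positive; negative; nonNegative; nonPositive)
import Data.Rational.Properties as ℚ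
open import Data.Rational.Solver using (module +-*-Solver)
open +-*-Solver using (solve; _:+_; _:*_; _:-_; _:=_; con)
open import Algebra.Properties.Group ℚ.+-0-group using (x∙y⁻¹≈ε⇒x≈y)
open import Relation.Binary.Definitions using (tri<; tri≈; tri>)
open import Relation.Nullary using (¬_; does; yes; no; contradiction)
open import Relation.Nullary.Decidable using (dec-true; dec-false)
open import Relation.Binary.PropositionalEquality
  using (refl; sym; trans; cong; cong₂; subst; _≢_; module ≡-Reasoning)


-- Finite sums

Σ-cong : ∀ {n} {f g : Vector ℚ n} → (∀ i → f i ≡ g i) → Σℚ f ≡ Σℚ g
Σ-cong {zero}  f≗g = refl
Σ-cong {suc n} f≗g = cong₂ _+_ (f≗g zero) (Σ-cong (f≗g ∘ suc))

Σ-zero : ∀ n → Σℚ {n} (λ _ → 0ℚ) ≡ 0ℚ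
Σ-zero zero    = refl
Σ-zero (suc n) = trans (ℚ.+-identityˡ _) (Σ-zero n)

Σ-distrib-+ : ∀ {n} (f g : Vector ℚ n) → Σℚ (λ i → f i + g i) ≡ Σℚ f + Σℚ g
Σ-distrib-+ {zero}  f g = refl
Σ-distrib-+ {suc n} f g =
  trans (cong ((f zero + g zero) +_) (Σ-distrib-+ (f ∘ suc) (g ∘ suc)))
        (solve 4 (λ a b c d → (a :+ b) :+ (c :+ d) := (a :+ c) :+ (b :+ d))
               refl (f zero) (g zero) _ _)

Σ-distrib-- : ∀ {n} (f g : Vector ℚ n) → Σℚ (λ i → f i - g i) ≡ Σℚ f - Σℚ g
Σ-distrib-- {zero}  f g = refl
Σ-distrib-- {suc n} f g =
  trans (cong ((f zero - g zero) +_) (Σ-distrib-- (f ∘ suc) (g ∘ suc)))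
        (solve 4 (λ a b c d → (a :- b) :+ (c :- d) := (a :+ c) :- (b :+ d))
               refl (f zero) (g zero) _ _)

*-distribˡ-Σ : ∀ {n} c (f : Vector ℚ n) → c * Σℚ f ≡ Σℚ (λ i → c * f i)
*-distribˡ-Σ {zero}  c f = ℚ.*-zeroʳ c
*-distribˡ-Σ {suc n} c f =
  trans (ℚ.*-distribˡ-+ c (f zero) _) (cong (c * f zero +_) (*-distribˡ-Σ c (f ∘ suc)))

*-distribʳ-Σ : ∀ {n} c (f : Vector ℚ n) → Σℚ f * c ≡ Σℚ (λ i → f i * c)
*-distribʳ-Σ {zero}  c f = ℚ.*-zeroˡ c
*-distribʳ-Σ {suc n} c f =
  trans (ℚ.*-distribʳ-+ c (f zero) _) (cong (f zero * c +_) (*-distribʳ-Σ c (f ∘ suc)))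

Σ-comm : ∀ {m n} (f : Fin m → Fin n → ℚ) →
         Σℚ (λ i → Σℚ (λ j → f i j)) ≡ Σℚ (λ j → Σℚ (λ i → f i j))
Σ-comm {zero}  {n} f = sym (Σ-zero n)
Σ-comm {suc m} {n} f =
  trans (cong (Σℚ (f zero) +_) (Σ-comm (f ∘ suc)))
        (sym (Σ-distrib-+ (f zero) (λ j → Σℚ (λ i → f (suc i) j))))

Σ-select : ∀ {n} (w : Fin n) (f : Vector ℚ n) →
           Σℚ (λ j → if does (w ≟ j) then f j else 0ℚ) ≡ f w
Σ-select {suc n} zero    f = trans (cong (f zero +_) (Σ-zero n)) (ℚ.+-identityʳ _)
Σ-select {suc n} (suc w) f = trans (ℚ.+-identityˡ _) (Σ-select w (f ∘ suc))

Σ-nonneg : ∀ {n} (f : Vector ℚ n) → (∀ i → 0ℚ ≤ f i) → 0ℚ ≤ Σℚ f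
Σ-nonneg {zero}  f 0≤f = ℚ.≤-refl
Σ-nonneg {suc n} f 0≤f = ℚ.+-mono-≤ (0≤f zero) (Σ-nonneg (f ∘ suc) (0≤f ∘ suc))

term≤Σ : ∀ {n} (f : Vector ℚ n) → (∀ i → 0ℚ ≤ f i) → ∀ k → f k ≤ Σℚ f
term≤Σ {suc n} f 0≤f zero =
  subst (_≤ Σℚ f) (ℚ.+-identityʳ (f zero))
        (ℚ.+-monoʳ-≤ (f zero) (Σ-nonneg (f ∘ suc) (0≤f ∘ suc)))
term≤Σ {suc n} f 0≤f (suc k) =
  subst (_≤ Σℚ f) (ℚ.+-identityˡ (f (suc k)))
        (ℚ.+-mono-≤ (0≤f zero) (term≤Σ (f ∘ suc) (0≤f ∘ suc) k))

term≤Σℕ : ∀ {n} (f : Fin n → ℕ) k → f k ℕ.≤ Σℕ f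
term≤Σℕ {suc n} f zero    = ℕ.m≤m+n (f zero) _
term≤Σℕ {suc n} f (suc k) = ℕ.≤-trans (term≤Σℕ (f ∘ suc) k) (ℕ.m≤n+m _ (f zero))

<⇒≱ : ∀ {p q} → p < q → ¬ (q ≤ p)
<⇒≱ p<q q≤p = ℚ.<-irrefl refl (ℚ.<-≤-trans p<q q≤p)

0≤p*p : ∀ p → 0ℚ ≤ p * p
0≤p*p p with ℚ.≤-total 0ℚ p
... | inj₁ 0≤p = ℚ.nonNegative⁻¹ _
  {{ℚ.nonNeg*nonNeg⇒nonNeg p {{nonNegative 0≤p}} p {{nonNegative 0≤p}}}}
... | inj₂ p≤0 = ℚ.nonNegative⁻¹ _
  {{ℚ.nonPos*nonPos⇒nonPos p {{nonPositive p≤0}} p {{nonPositive p≤0}}}}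

p*p≤0⇒p≡0 : ∀ p → p * p ≤ 0ℚ → p ≡ 0ℚ
p*p≤0⇒p≡0 p p*p≤0 with ℚ.<-cmp p 0ℚ
... | tri< p<0 _ _ = contradiction p*p≤0 (<⇒≱ (ℚ.positive⁻¹ _
  {{ℚ.neg*neg⇒pos p {{negative p<0}} p {{negative p<0}}}}))
... | tri≈ _ p≡0 _ = p≡0
... | tri> _ _ p>0 = contradiction p*p≤0 (<⇒≱ (ℚ.positive⁻¹ _
  {{ℚ.pos*pos⇒pos p {{positive p>0}} p {{positive p>0}}}}))

0≤p+p⇒0≤p : ∀ {p} → 0ℚ ≤ p + p → 0ℚ ≤ p
0≤p+p⇒0≤p 0≤p+p = ℚ.≮⇒≥ (λ p<0 → <⇒≱ (ℚ.+-mono-< p<0 p<0) 0≤p+p)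

-- The embedding ℕ → ℚ

-- ℕ→ℚ k is already in lowest terms, which reduces its arithmetic to that of the numerators.
ℕ→ℚ≡mkℚ : ∀ k → ℕ→ℚ k ≡ mkℚ (ℤ.+ k) 0 (Coprime.sym (Coprime.1-coprimeTo k))
ℕ→ℚ≡mkℚ k = ℚ.normalize-coprime (Coprime.sym (Coprime.1-coprimeTo k))

ℕ→ℚ-+ : ∀ a b → ℕ→ℚ (a ℕ.+ b) ≡ ℕ→ℚ a + ℕ→ℚ b
ℕ→ℚ-+ a b rewrite ℕ→ℚ≡mkℚ a | ℕ→ℚ≡mkℚ b =
  ℚ./-cong (trans (ℤ.pos-+ a b) (sym (cong₂ ℤ._+_ (ℤ.*-identityʳ (ℤ.+ a)) (ℤ.*-identityʳ (ℤ.+ b)))))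
           refl

ℕ→ℚ-* : ∀ a b → ℕ→ℚ (a ℕ.* b) ≡ ℕ→ℚ a * ℕ→ℚ b
ℕ→ℚ-* a b rewrite ℕ→ℚ≡mkℚ a | ℕ→ℚ≡mkℚ b = ℚ./-cong (ℤ.pos-* a b) refl

ℕ→ℚ-∸ : ∀ {a b} → b ℕ.≤ a → ℕ→ℚ (a ∸ b) ≡ ℕ→ℚ a - ℕ→ℚ b
ℕ→ℚ-∸ {a} {b} b≤a = begin
  ℕ→ℚ (a ∸ b)
    ≡⟨ solve 2 (λ x y → x := (x :+ y) :- y) refl (ℕ→ℚ (a ∸ b)) (ℕ→ℚ b) ⟩
  ℕ→ℚ (a ∸ b) + ℕ→ℚ b - ℕ→ℚ b
    ≡⟨ cong (_- ℕ→ℚ b) (ℕ→ℚ-+ (a ∸ b) b) ⟨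
  ℕ→ℚ (a ∸ b ℕ.+ b) - ℕ→ℚ b
    ≡⟨ cong (λ k → ℕ→ℚ k - ℕ→ℚ b) (ℕ.m∸n+n≡m b≤a) ⟩
  ℕ→ℚ a - ℕ→ℚ b ∎
  where open ≡-Reasoning

ℕ→ℚ-Σ : ∀ {n} (f : Fin n → ℕ) → ℕ→ℚ (Σℕ f) ≡ Σℚ (ℕ→ℚ ∘ f)
ℕ→ℚ-Σ {zero}  f = refl
ℕ→ℚ-Σ {suc n} f = trans (ℕ→ℚ-+ (f zero) _) (cong (ℕ→ℚ (f zero) +_) (ℕ→ℚ-Σ (f ∘ suc)))

÷ℕ-*-cancel : ∀ m k .{{_ : ℕ.NonZero k}} → (m ÷ℕ k) * ℕ→ℚ k ≡ ℕ→ℚ m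
÷ℕ-*-cancel m (suc k) = begin
  (m ÷ℕ suc k) * ℕ→ℚ (suc k)   ≡⟨ cong₂ _*_ m÷ℕk≡m*1/k (ℕ→ℚ≡mkℚ (suc k)) ⟩
  (ℕ→ℚ m * 1/ K) * K           ≡⟨ ℚ.*-assoc (ℕ→ℚ m) (1/ K) K ⟩
  ℕ→ℚ m * (1/ K * K)           ≡⟨ cong (ℕ→ℚ m *_) (ℚ.*-inverseˡ K) ⟩
  ℕ→ℚ m * 1ℚ                   ≡⟨ ℚ.*-identityʳ (ℕ→ℚ m) ⟩
  ℕ→ℚ m                        ∎
  where
  open ≡-Reasoning
  K = mkℚ (ℤ.+ suc k) 0 (Coprime.sym (Coprime.1-coprimeTo (suc k)))
  m÷ℕk≡m*1/k : m ÷ℕ suc k ≡ ℕ→ℚ m * 1/ K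
  m÷ℕk≡m*1/k rewrite ℕ→ℚ≡mkℚ m =
    ℚ./-cong (sym (ℤ.*-identityʳ (ℤ.+ m))) (sym (ℕ.*-identityˡ (suc k)))

÷ℕ≡*1÷ℕ : ∀ m k .{{_ : ℕ.NonZero k}} → m ÷ℕ k ≡ ℕ→ℚ m * (1 ÷ℕ k)
÷ℕ≡*1÷ℕ m k = begin
  m ÷ℕ k                  ≡⟨ ℚ.*-identityʳ (m ÷ℕ k) ⟨
  m ÷ℕ k * 1ℚ             ≡⟨ cong (m ÷ℕ k *_) (÷ℕ-*-cancel 1 k) ⟨
  m ÷ℕ k * (l * K)        ≡⟨ solve 3 (λ x l K → x :* (l :* K) := (x :* K) :* l) refl (m ÷ℕ k) l K ⟩
  (m ÷ℕ k * K) * l        ≡⟨ cong (_* l) (÷ℕ-*-cancel m k) ⟩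
  ℕ→ℚ m * l               ∎
  where
  open ≡-Reasoning
  K = ℕ→ℚ k
  l = 1 ÷ℕ k

-- Vectors and matrices over ℚ

_*ᵥ_ : ∀ {n} → Matrix n → Vector ℚ n → Vector ℚ n
(M *ᵥ y) i = Σℚ (λ j → M i j * y j)

⟨_,_⟩ : ∀ {n} → Vector ℚ n → Vector ℚ n → ℚ
⟨ x , y ⟩ = Σℚ (λ i → x i * y i)

Symmetric : ∀ {n} → Matrix n → Set
Symmetric M = ∀ i j → M i j ≡ M j i

PositiveSemidefinite : ∀ {n} → Matrix n → Set
PositiveSemidefinite M = ∀ y → 0ℚ ≤ ⟨ y , M *ᵥ y ⟩

incidence : ∀ {n} → Fin n → Fin n → Vector ℚ n
incidence u v x = indicator u x - indicator v x

dipole : ∀ {n} → Fin n → Fin n → ℚ → ℚ → Vector ℚ n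
dipole u v p q x = p * indicator u x - q * indicator v x

indicator-refl : ∀ {n} (w : Fin n) → indicator w w ≡ 1ℚ
indicator-refl w rewrite dec-true (w ≟ w) refl = refl

indicator-≢ : ∀ {n} {w x : Fin n} → w ≢ x → indicator w x ≡ 0ℚ
indicator-≢ {w = w} {x} w≢x rewrite dec-false (w ≟ x) w≢x = refl

indicator-sym : ∀ {n} (w x : Fin n) → indicator w x ≡ indicator x w
indicator-sym w x with w ≟ x | x ≟ w
... | yes _   | yes _   = refl
... | yes w≡x | no  x≢w = contradiction (sym w≡x) x≢w
... | no  w≢x | yes x≡w = contradiction (sym x≡w) w≢x
... | no  _   | no  _   = refl

⟨⟩-comm : ∀ {n} (x y : Vector ℚ n) → ⟨ x , y ⟩ ≡ ⟨ y , x ⟩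
⟨⟩-comm x y = Σ-cong (λ i → ℚ.*-comm (x i) (y i))

⟨⟩-distribˡ-- : ∀ {n} (x y w : Vector ℚ n) → ⟨ (λ i → x i - y i) , w ⟩ ≡ ⟨ x , w ⟩ - ⟨ y , w ⟩
⟨⟩-distribˡ-- x y w =
  trans (Σ-cong (λ i → solve 3 (λ x y w → (x :- y) :* w := x :* w :- y :* w) refl (x i) (y i) (w i)))
        (Σ-distrib-- (λ i → x i * w i) (λ i → y i * w i))

⟨⟩-distribʳ-- : ∀ {n} (w x y : Vector ℚ n) → ⟨ w , (λ i → x i - y i) ⟩ ≡ ⟨ w , x ⟩ - ⟨ w , y ⟩
⟨⟩-distribʳ-- w x y =
  trans (Σ-cong (λ i → solve 3 (λ w x y → w :* (x :- y) := w :* x :- w :* y) refl (w i) (x i) (y i)))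
        (Σ-distrib-- (λ i → w i * x i) (λ i → w i * y i))

⟨⟩-scaleʳ : ∀ {n} (w : Vector ℚ n) c (x : Vector ℚ n) → ⟨ w , (λ i → c * x i) ⟩ ≡ c * ⟨ w , x ⟩
⟨⟩-scaleʳ w c x =
  trans (Σ-cong (λ i → solve 3 (λ w c x → w :* (c :* x) := c :* (w :* x)) refl (w i) c (x i)))
        (sym (*-distribˡ-Σ c (λ i → w i * x i)))

⟨⟩-indicatorʳ : ∀ {n} (g : Vector ℚ n) (w : Fin n) → ⟨ g , indicator w ⟩ ≡ g w
⟨⟩-indicatorʳ g w = trans (Σ-cong g*1w≡select) (Σ-select w g)
  where
  g*1w≡select : ∀ j → g j * indicator w j ≡ (if does (w ≟ j) then g j else 0ℚ)
  g*1w≡select j with does (w ≟ j)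
  ... | true  = ℚ.*-identityʳ (g j)
  ... | false = ℚ.*-zeroʳ (g j)

⟨⟩-incidenceʳ : ∀ {n} (g : Vector ℚ n) (u v : Fin n) → ⟨ g , incidence u v ⟩ ≡ g u - g v
⟨⟩-incidenceʳ g u v =
  trans (⟨⟩-distribʳ-- g (indicator u) (indicator v)) (cong₂ _-_ (⟨⟩-indicatorʳ g u) (⟨⟩-indicatorʳ g v))

⟨⟩-dipoleʳ : ∀ {n} (g : Vector ℚ n) (u v : Fin n) p q → ⟨ g , dipole u v p q ⟩ ≡ p * g u - q * g v
⟨⟩-dipoleʳ g u v p q = begin
  ⟨ g , dipole u v p q ⟩
    ≡⟨ ⟨⟩-distribʳ-- g (λ j → p * indicator u j) (λ j → q * indicator v j) ⟩
  ⟨ g , (λ j → p * indicator u j) ⟩ - ⟨ g , (λ j → q * indicator v j) ⟩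
    ≡⟨ cong₂ _-_ (⟨⟩-scaleʳ g p (indicator u)) (⟨⟩-scaleʳ g q (indicator v)) ⟩
  p * ⟨ g , indicator u ⟩ - q * ⟨ g , indicator v ⟩
    ≡⟨ cong₂ (λ a b → p * a - q * b) (⟨⟩-indicatorʳ g u) (⟨⟩-indicatorʳ g v) ⟩
  p * g u - q * g v ∎
  where open ≡-Reasoning

⟨⟩-*ᵥ-sym : ∀ {n} {M : Matrix n} → Symmetric M → ∀ x y → ⟨ x , M *ᵥ y ⟩ ≡ ⟨ y , M *ᵥ x ⟩
⟨⟩-*ᵥ-sym {M = M} M-sym x y = begin
  Σℚ (λ i → x i * Σℚ (λ j → M i j * y j))
    ≡⟨ Σ-cong (λ i → *-distribˡ-Σ (x i) (λ j → M i j * y j)) ⟩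
  Σℚ (λ i → Σℚ (λ j → x i * (M i j * y j)))
    ≡⟨ Σ-comm (λ i j → x i * (M i j * y j)) ⟩
  Σℚ (λ j → Σℚ (λ i → x i * (M i j * y j)))
    ≡⟨ Σ-cong (λ j → Σ-cong (λ i → cong (λ m → x i * (m * y j)) (M-sym i j))) ⟩
  Σℚ (λ j → Σℚ (λ i → x i * (M j i * y j)))
    ≡⟨ Σ-cong (λ j → Σ-cong (λ i →
         solve 3 (λ a m c → a :* (m :* c) := c :* (m :* a)) refl (x i) (M j i) (y j))) ⟩
  Σℚ (λ j → Σℚ (λ i → y j * (M j i * x i)))
    ≡⟨ Σ-cong (λ j → sym (*-distribˡ-Σ (y j) (λ i → M j i * x i))) ⟩
  Σℚ (λ j → y j * Σℚ (λ i → M j i * x i)) ∎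
  where open ≡-Reasoning

·-assoc : ∀ {n} (A B C : Matrix n) i j → (A · (B · C)) i j ≡ ((A · B) · C) i j
·-assoc A B C i j = begin
  Σℚ (λ k → A i k * Σℚ (λ l → B k l * C l j))
    ≡⟨ Σ-cong (λ k → *-distribˡ-Σ (A i k) (λ l → B k l * C l j)) ⟩
  Σℚ (λ k → Σℚ (λ l → A i k * (B k l * C l j)))
    ≡⟨ Σ-comm (λ k l → A i k * (B k l * C l j)) ⟩
  Σℚ (λ l → Σℚ (λ k → A i k * (B k l * C l j)))
    ≡⟨ Σ-cong (λ l → Σ-cong (λ k → sym (ℚ.*-assoc (A i k) (B k l) (C l j)))) ⟩
  Σℚ (λ l → Σℚ (λ k → A i k * B k l * C l j))
    ≡⟨ Σ-cong (λ l → sym (*-distribʳ-Σ (C l j) (λ k → A i k * B k l))) ⟩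
  Σℚ (λ l → Σℚ (λ k → A i k * B k l) * C l j) ∎
  where open ≡-Reasoning

2⟨x,b⟩-⟨x,Lx⟩≤⟨z,b⟩ : ∀ {n} {L : Matrix n} → Symmetric L → PositiveSemidefinite L →
  ∀ {z b} → (∀ i → (L *ᵥ z) i ≡ b i) →
  ∀ x → ⟨ x , b ⟩ + ⟨ x , b ⟩ - ⟨ x , L *ᵥ x ⟩ ≤ ⟨ z , b ⟩
2⟨x,b⟩-⟨x,Lx⟩≤⟨z,b⟩ {L = L} L-sym L-psd {z} {b} Lz≡b x = begin
  trial                             ≡⟨ ℚ.+-identityˡ trial ⟨
  0ℚ + trial                        ≤⟨ ℚ.+-monoˡ-≤ trial (L-psd z-x) ⟩
  ⟨ z-x , L *ᵥ z-x ⟩ + trial        ≡⟨ cong (_+ trial) gap ⟩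
  ((zb - xb) - (xb - xLx)) + trial  ≡⟨ solve 3 (λ zb xb xLx →
                                         ((zb :- xb) :- (xb :- xLx)) :+ ((xb :+ xb) :- xLx) := zb)
                                       refl zb xb xLx ⟩
  zb                                ∎
  where
  open ℚ.≤-Reasoning
  z-x = λ i → z i - x i
  xb = ⟨ x , b ⟩
  zb = ⟨ z , b ⟩
  xLx = ⟨ x , L *ᵥ x ⟩
  trial = xb + xb - xLx
  L[z-x]≡b-Lx : ∀ i → (L *ᵥ z-x) i ≡ b i - (L *ᵥ x) i
  L[z-x]≡b-Lx i = trans (⟨⟩-distribʳ-- (L i) z x) (cong (_- (L *ᵥ x) i) (Lz≡b i))
  zLx≡xb : ⟨ z , L *ᵥ x ⟩ ≡ xb
  zLx≡xb = trans (⟨⟩-*ᵥ-sym L-sym z x) (Σ-cong (λ i → cong (x i *_) (Lz≡b i)))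
  gap : ⟨ z-x , L *ᵥ z-x ⟩ ≡ (zb - xb) - (xb - xLx)
  gap = begin-equality
    ⟨ z-x , L *ᵥ z-x ⟩
      ≡⟨ Σ-cong (λ i → cong (z-x i *_) (L[z-x]≡b-Lx i)) ⟩
    ⟨ z-x , (λ i → b i - (L *ᵥ x) i) ⟩
      ≡⟨ ⟨⟩-distribˡ-- z x _ ⟩
    ⟨ z , (λ i → b i - (L *ᵥ x) i) ⟩ - ⟨ x , (λ i → b i - (L *ᵥ x) i) ⟩
      ≡⟨ cong₂ _-_ (⟨⟩-distribʳ-- z b (L *ᵥ x)) (⟨⟩-distribʳ-- x b (L *ᵥ x)) ⟩
    (zb - ⟨ z , L *ᵥ x ⟩) - (xb - xLx)
      ≡⟨ cong (λ t → (zb - t) - (xb - xLx)) zLx≡xb ⟩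
    (zb - xb) - (xb - xLx) ∎

effRes≡⟨rowDifference,incidence⟩ : ∀ {n} (M : Matrix n) u v →
  effRes M u v ≡ ⟨ (λ k → M u k - M v k) , incidence u v ⟩
effRes≡⟨rowDifference,incidence⟩ M u v = begin
  Σℚ (λ i → Σℚ (λ j → b i * M i j * b j))
    ≡⟨ Σ-comm (λ i j → b i * M i j * b j) ⟩
  Σℚ (λ j → Σℚ (λ i → b i * M i j * b j))
    ≡⟨ Σ-cong (λ j → sym (*-distribʳ-Σ (b j) (λ i → b i * M i j))) ⟩
  Σℚ (λ j → ⟨ b , (λ i → M i j) ⟩ * b j)
    ≡⟨ Σ-cong (λ j → cong (_* b j)
         (trans (⟨⟩-comm b (λ i → M i j)) (⟨⟩-incidenceʳ (λ i → M i j) u v))) ⟩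
  Σℚ (λ j → (M u j - M v j) * b j) ∎
  where
  open ≡-Reasoning
  b = incidence u v

⟨dipole,incidence⟩ : ∀ {n} {u v : Fin n} → u ≢ v →
  ∀ p q → ⟨ dipole u v p q , incidence u v ⟩ ≡ p + q
⟨dipole,incidence⟩ {u = u} {v} u≢v p q = begin
  ⟨ dipole u v p q , incidence u v ⟩
    ≡⟨ ⟨⟩-incidenceʳ (dipole u v p q) u v ⟩
  (p * indicator u u - q * indicator v u) - (p * indicator u v - q * indicator v v)
    ≡⟨ cong₂ (λ a b → (p * a - q * indicator v u) - (p * indicator u v - q * b))
             (indicator-refl u) (indicator-refl v) ⟩
  (p * 1ℚ - q * indicator v u) - (p * indicator u v - q * 1ℚ)
    ≡⟨ cong₂ (λ a b → (p * 1ℚ - q * a) - (p * b - q * 1ℚ))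
             (indicator-≢ (u≢v ∘ sym)) (indicator-≢ u≢v) ⟩
  (p * 1ℚ - q * 0ℚ) - (p * 0ℚ - q * 1ℚ)
    ≡⟨ solve 2 (λ p q → (p :* con 1ℚ :- q :* con 0ℚ) :- (p :* con 0ℚ :- q :* con 1ℚ) := p :+ q) refl p q ⟩
  p + q ∎
  where open ≡-Reasoning

-- Optimising the dipole bound

dipoleBound : ℚ → ℚ → ℚ → ℚ → ℚ
dipoleBound du dv p q = (p + q) + (p + q) - (p * (p * du + q) + q * (p + q * dv))

≡-modulo-inverse : ∀ {a} x l D → a ≡ x + x * (1ℚ - l * D) → l * D ≡ 1ℚ → a ≡ x
≡-modulo-inverse {a} x l D a≡ lD≡1 = begin
  a                        ≡⟨ a≡ ⟩
  x + x * (1ℚ - l * D)     ≡⟨ cong (λ t → x + x * (1ℚ - t)) lD≡1 ⟩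
  x + x * (1ℚ - 1ℚ)        ≡⟨ solve 1 (λ x → x :+ x :* (con 1ℚ :- con 1ℚ) := x) refl x ⟩
  x                        ∎
  where open ≡-Reasoning

-- With α = d_v - 1, β = d_u - 1 and D = d_u d_v - 1 = αβ + α + β, the quadratic part at
-- (α/D, β/D) is (α + β) D / D², so the bound equals (α + β) / D.
dipoleBound-at-[dv-1,du-1]/D : ∀ du dv l → l * (du * dv - 1ℚ) ≡ 1ℚ →
  dipoleBound du dv (l * (dv - 1ℚ)) (l * (du - 1ℚ)) ≡ (dv + du - ℕ→ℚ 2) * l
dipoleBound-at-[dv-1,du-1]/D du dv l = ≡-modulo-inverse N l (du * dv - 1ℚ)
  (solve 3 (λ du dv l →
     let p = l :* (dv :- con 1ℚ); q = l :* (du :- con 1ℚ); N = (dv :+ du :- con (ℕ→ℚ 2)) :* l in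
     (p :+ q) :+ (p :+ q) :- (p :* (p :* du :+ q) :+ q :* (p :+ q :* dv))
       := N :+ N :* (con 1ℚ :- l :* (du :* dv :- con 1ℚ)))
   refl du dv l)
  where N = (dv + du - ℕ→ℚ 2) * l

dipoleBound-at-2/S : ∀ du dv t → t * (du + dv + ℕ→ℚ 2) ≡ 1ℚ →
  dipoleBound du dv (ℕ→ℚ 2 * t) (ℕ→ℚ 2 * t) ≡ ℕ→ℚ 4 * t
dipoleBound-at-2/S du dv t = ≡-modulo-inverse N t (du + dv + ℕ→ℚ 2)
  (solve 3 (λ du dv t →
     let p = con (ℕ→ℚ 2) :* t; N = con (ℕ→ℚ 4) :* t in
     (p :+ p) :+ (p :+ p) :- (p :* (p :* du :+ p) :+ p :* (p :+ p :* dv))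
       := N :+ N :* (con 1ℚ :- t :* (du :+ dv :+ con (ℕ→ℚ 2))))
   refl du dv t)
  where N = ℕ→ℚ 4 * t

2≤m*n : ∀ {m n} → 1 ℕ.≤ m → 1 ℕ.≤ n → 2 ℕ.≤ m ⊎ 2 ℕ.≤ n → 2 ℕ.≤ m ℕ.* n
2≤m*n 1≤m 1≤n (inj₁ 2≤m) = ℕ.*-mono-≤ 2≤m 1≤n
2≤m*n 1≤m 1≤n (inj₂ 2≤n) = ℕ.*-mono-≤ 1≤m 2≤n

module _ {r : ℚ} (du dv : ℕ) (bound : ∀ p q → dipoleBound (ℕ→ℚ du) (ℕ→ℚ dv) p q ≤ r) where
  open ℚ.≤-Reasoning

  [du+dv-2]/[du*dv-1]≤ : 1 ℕ.≤ du → 1 ℕ.≤ dv → 2 ℕ.≤ du ℕ.* dv →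
    ((dv ℕ.+ du) ∸ 2) ÷ℕ ((du ℕ.* dv) ∸ 1) ≤ r
  [du+dv-2]/[du*dv-1]≤ 1≤du 1≤dv 2≤du*dv = begin
    ((dv ℕ.+ du) ∸ 2) ÷ℕ D
      ≡⟨ ÷ℕ≡*1÷ℕ _ D ⟩
    ℕ→ℚ ((dv ℕ.+ du) ∸ 2) * l
      ≡⟨ cong (_* l) ℕ→ℚN ⟩
    (ℕ→ℚ dv + ℕ→ℚ du - ℕ→ℚ 2) * l
      ≡⟨ dipoleBound-at-[dv-1,du-1]/D (ℕ→ℚ du) (ℕ→ℚ dv) l lD≡1 ⟨
    dipoleBound (ℕ→ℚ du) (ℕ→ℚ dv) (l * (ℕ→ℚ dv - 1ℚ)) (l * (ℕ→ℚ du - 1ℚ))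
      ≤⟨ bound (l * (ℕ→ℚ dv - 1ℚ)) (l * (ℕ→ℚ du - 1ℚ)) ⟩
    r ∎
    where
    D = (du ℕ.* dv) ∸ 1
    instance
      D≢0 : ℕ.NonZero D
      D≢0 = ℕ.>-nonZero (ℕ.m<n⇒0<n∸m 2≤du*dv)
    l = 1 ÷ℕ D
    ℕ→ℚN : ℕ→ℚ ((dv ℕ.+ du) ∸ 2) ≡ ℕ→ℚ dv + ℕ→ℚ du - ℕ→ℚ 2
    ℕ→ℚN = trans (ℕ→ℚ-∸ (ℕ.+-mono-≤ 1≤dv 1≤du)) (cong (_- ℕ→ℚ 2) (ℕ→ℚ-+ dv du))
    lD≡1 : l * (ℕ→ℚ du * ℕ→ℚ dv - 1ℚ) ≡ 1ℚ
    lD≡1 = begin-equality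
      l * (ℕ→ℚ du * ℕ→ℚ dv - 1ℚ)    ≡⟨ cong (λ t → l * (t - 1ℚ)) (ℕ→ℚ-* du dv) ⟨
      l * (ℕ→ℚ (du ℕ.* dv) - 1ℚ)    ≡⟨ cong (l *_) (ℕ→ℚ-∸ (ℕ.<⇒≤ 2≤du*dv)) ⟨
      l * ℕ→ℚ D                     ≡⟨ ÷ℕ-*-cancel 1 D ⟩
      1ℚ                            ∎

  4/[du+dv+2]≤ : 4 ÷ℕ (du ℕ.+ dv ℕ.+ 2) ≤ r
  4/[du+dv+2]≤ = begin
    4 ÷ℕ S
      ≡⟨ ÷ℕ≡*1÷ℕ 4 S ⟩
    ℕ→ℚ 4 * t
      ≡⟨ dipoleBound-at-2/S (ℕ→ℚ du) (ℕ→ℚ dv) t tS≡1 ⟨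
    dipoleBound (ℕ→ℚ du) (ℕ→ℚ dv) (ℕ→ℚ 2 * t) (ℕ→ℚ 2 * t)
      ≤⟨ bound (ℕ→ℚ 2 * t) (ℕ→ℚ 2 * t) ⟩
    r ∎
    where
    S = du ℕ.+ dv ℕ.+ 2
    instance
      S≢0 : ℕ.NonZero S
      S≢0 = ℕ.>-nonZero (ℕ.≤-trans (ℕ.s≤s ℕ.z≤n) (ℕ.m≤n+m 2 (du ℕ.+ dv)))
    t = 1 ÷ℕ S
    tS≡1 : t * (ℕ→ℚ du + ℕ→ℚ dv + ℕ→ℚ 2) ≡ 1ℚ
    tS≡1 = begin-equality
      t * (ℕ→ℚ du + ℕ→ℚ dv + ℕ→ℚ 2)  ≡⟨ cong (λ x → t * (x + ℕ→ℚ 2)) (ℕ→ℚ-+ du dv) ⟨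
      t * (ℕ→ℚ (du ℕ.+ dv) + ℕ→ℚ 2)  ≡⟨ cong (t *_) (ℕ→ℚ-+ (du ℕ.+ dv) 2) ⟨
      t * ℕ→ℚ S                      ≡⟨ ÷ℕ-*-cancel 1 S ⟩
      1ℚ                             ∎

-- The Laplacian of a simple graph

module Laplacian {n} (G : SimpleGraph n) where

  A : Matrix n
  A i j = boolℚ (adj G i j)

  L : Matrix n
  L = laplacian G

  d : Vector ℚ n
  d w = ℕ→ℚ (degree G w)

  adj⇒≢ : ∀ {u v} → adj G u v ≡ true → u ≢ v
  adj⇒≢ {u} uv refl with trans (sym uv) (loopless G u)
  ... | ()

  adj⇒1≤degree : ∀ {u v} → adj G u v ≡ true → 1 ℕ.≤ degree G u
  adj⇒1≤degree {u} {v} uv = subst (λ b → boolℕ b ℕ.≤ degree G u) uv (term≤Σℕ (boolℕ ∘ adj G u) v)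

  d≡ΣA : ∀ i → d i ≡ Σℚ (A i)
  d≡ΣA i = trans (ℕ→ℚ-Σ (boolℕ ∘ adj G i)) (Σ-cong (λ j → boolℕ→ℚ (adj G i j)))
    where
    boolℕ→ℚ : ∀ b → ℕ→ℚ (boolℕ b) ≡ boolℚ b
    boolℕ→ℚ true  = refl
    boolℕ→ℚ false = refl

  L-sym : Symmetric L
  L-sym i j with i ≟ j | j ≟ i
  ... | yes refl | yes _   = refl
  ... | yes i≡j  | no  j≢i = contradiction (sym i≡j) j≢i
  ... | no  i≢j  | yes j≡i = contradiction (sym j≡i) i≢j
  ... | no  _    | no  _   = cong (λ a → 0ℚ - boolℚ a) (symmetric G i j)

  L-diag : ∀ w → L w w ≡ d w
  L-diag w rewrite dec-true (w ≟ w) refl | loopless G w = ℚ.+-identityʳ (d w)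

  L-adj : ∀ {i j} → adj G i j ≡ true → L i j ≡ - 1ℚ
  L-adj {i} {j} ij rewrite dec-false (i ≟ j) (adj⇒≢ ij) | ij = refl

  L*ᵥ≡ΣA[yi-yj] : ∀ y i → (L *ᵥ y) i ≡ Σℚ (λ j → A i j * (y i - y j))
  L*ᵥ≡ΣA[yi-yj] y i = begin
    Σℚ (λ j → (δd j - A i j) * y j)
      ≡⟨ Σ-cong (λ j → solve 3 (λ a b y → (a :- b) :* y := a :* y :- b :* y) refl (δd j) (A i j) (y j)) ⟩
    Σℚ (λ j → δd j * y j - A i j * y j)
      ≡⟨ Σ-distrib-- (λ j → δd j * y j) (λ j → A i j * y j) ⟩
    Σℚ (λ j → δd j * y j) - Σℚ (λ j → A i j * y j)
      ≡⟨ cong (_- Σℚ (λ j → A i j * y j)) (trans (Σ-cong δd*y≡select) (Σ-select i (λ j → d i * y j))) ⟩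
    d i * y i - Σℚ (λ j → A i j * y j)
      ≡⟨ cong (λ t → t * y i - Σℚ (λ j → A i j * y j)) (d≡ΣA i) ⟩
    Σℚ (A i) * y i - Σℚ (λ j → A i j * y j)
      ≡⟨ cong (_- Σℚ (λ j → A i j * y j)) (*-distribʳ-Σ (y i) (A i)) ⟩
    Σℚ (λ j → A i j * y i) - Σℚ (λ j → A i j * y j)
      ≡⟨ ⟨⟩-distribʳ-- (A i) (λ _ → y i) y ⟨
    Σℚ (λ j → A i j * (y i - y j)) ∎
    where
    open ≡-Reasoning
    δd : Vector ℚ n
    δd j = if does (i ≟ j) then d i else 0ℚ
    δd*y≡select : ∀ j → δd j * y j ≡ (if does (i ≟ j) then d i * y j else 0ℚ)
    δd*y≡select j with does (i ≟ j)
    ... | true  = refl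
    ... | false = ℚ.*-zeroˡ (y j)

  2⟨y,Ly⟩≡ΣA[yi-yj]² : ∀ y → ⟨ y , L *ᵥ y ⟩ + ⟨ y , L *ᵥ y ⟩ ≡
                            Σℚ (λ i → Σℚ (λ j → A i j * ((y i - y j) * (y i - y j))))
  2⟨y,Ly⟩≡ΣA[yi-yj]² y = begin
    ⟨ y , L *ᵥ y ⟩ + ⟨ y , L *ᵥ y ⟩
      ≡⟨ cong₂ _+_ ⟨y,Ly⟩≡ΣF (trans ⟨y,Ly⟩≡ΣF (Σ-comm F)) ⟩
    Σℚ (λ i → Σℚ (F i)) + Σℚ (λ i → Σℚ (λ j → F j i))
      ≡⟨ Σ-distrib-+ (λ i → Σℚ (F i)) (λ i → Σℚ (λ j → F j i)) ⟨
    Σℚ (λ i → Σℚ (F i) + Σℚ (λ j → F j i))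
      ≡⟨ Σ-cong (λ i → Σ-distrib-+ (F i) (λ j → F j i)) ⟨
    Σℚ (λ i → Σℚ (λ j → F i j + F j i))
      ≡⟨ Σ-cong (λ i → Σ-cong (λ j → Fij+Fji i j)) ⟩
    Σℚ (λ i → Σℚ (λ j → A i j * ((y i - y j) * (y i - y j)))) ∎
    where
    open ≡-Reasoning
    F : Fin n → Fin n → ℚ
    F i j = y i * (A i j * (y i - y j))
    ⟨y,Ly⟩≡ΣF : ⟨ y , L *ᵥ y ⟩ ≡ Σℚ (λ i → Σℚ (F i))
    ⟨y,Ly⟩≡ΣF = Σ-cong (λ i → trans (cong (y i *_) (L*ᵥ≡ΣA[yi-yj] y i))
                                    (*-distribˡ-Σ (y i) (λ j → A i j * (y i - y j))))
    Fij+Fji : ∀ i j → F i j + F j i ≡ A i j * ((y i - y j) * (y i - y j))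
    Fij+Fji i j = trans (cong (λ a → F i j + y j * (a * (y j - y i))) (cong boolℚ (symmetric G j i)))
      (solve 3 (λ a p q → p :* (a :* (p :- q)) :+ q :* (a :* (q :- p)) := a :* ((p :- q) :* (p :- q)))
             refl (A i j) (y i) (y j))

  0≤A[yi-yj]² : ∀ (y : Vector ℚ n) i j → 0ℚ ≤ A i j * ((y i - y j) * (y i - y j))
  0≤A[yi-yj]² y i j with adj G i j
  ... | true  = subst (0ℚ ≤_) (sym (ℚ.*-identityˡ _)) (0≤p*p (y i - y j))
  ... | false = ℚ.≤-reflexive (sym (ℚ.*-zeroˡ ((y i - y j) * (y i - y j))))

  L-psd : PositiveSemidefinite L
  L-psd y = 0≤p+p⇒0≤p (subst (0ℚ ≤_) (sym (2⟨y,Ly⟩≡ΣA[yi-yj]² y))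
    (Σ-nonneg _ (λ i → Σ-nonneg _ (0≤A[yi-yj]² y i))))

  L*ᵥy≡0⇒yu≡yv : ∀ {y u v} → adj G u v ≡ true → (∀ i → (L *ᵥ y) i ≡ 0ℚ) → y u ≡ y v
  L*ᵥy≡0⇒yu≡yv {y} {u} {v} uv Ly≡0 = x∙y⁻¹≈ε⇒x≈y (y u) (y v) (p*p≤0⇒p≡0 (y u - y v) [yu-yv]²≤0)
    where
    open ℚ.≤-Reasoning
    E : Fin n → Fin n → ℚ
    E i j = A i j * ((y i - y j) * (y i - y j))
    ⟨y,Ly⟩≡0 : ⟨ y , L *ᵥ y ⟩ ≡ 0ℚ
    ⟨y,Ly⟩≡0 = trans (Σ-cong (λ i → trans (cong (y i *_) (Ly≡0 i)) (ℚ.*-zeroʳ (y i)))) (Σ-zero n)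
    [yu-yv]²≤0 : (y u - y v) * (y u - y v) ≤ 0ℚ
    [yu-yv]²≤0 = begin
      (y u - y v) * (y u - y v)          ≡⟨ ℚ.*-identityˡ _ ⟨
      1ℚ * ((y u - y v) * (y u - y v))   ≡⟨ cong (λ b → boolℚ b * ((y u - y v) * (y u - y v))) uv ⟨
      E u v                              ≤⟨ term≤Σ (E u) (0≤A[yi-yj]² y u) v ⟩
      Σℚ (E u)                           ≤⟨ term≤Σ (Σℚ ∘ E) (λ i → Σ-nonneg (E i) (0≤A[yi-yj]² y i)) u ⟩
      Σℚ (λ i → Σℚ (E i))                ≡⟨ 2⟨y,Ly⟩≡ΣA[yi-yj]² y ⟨
      ⟨ y , L *ᵥ y ⟩ + ⟨ y , L *ᵥ y ⟩    ≡⟨ cong (λ t → t + t) ⟨y,Ly⟩≡0 ⟩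
      0ℚ                                 ∎

  ⟨Lw,Mx⟩≡[ML]xw : ∀ (M : Matrix n) x w → ⟨ L w , M x ⟩ ≡ (M · L) x w
  ⟨Lw,Mx⟩≡[ML]xw M x w = trans (⟨⟩-comm (L w) (M x)) (Σ-cong (λ k → cong (M x k *_) (L-sym w k)))

  module _ {M : Matrix n} (LML≡L : ∀ i j → ((L · M) · L) i j ≡ L i j) where

    L*ᵥ[1w-MLw]≡0 : ∀ w i → (L *ᵥ (λ j → indicator w j - (M · L) j w)) i ≡ 0ℚ
    L*ᵥ[1w-MLw]≡0 w i = begin
      ⟨ L i , (λ j → indicator w j - (M · L) j w) ⟩
        ≡⟨ ⟨⟩-distribʳ-- (L i) (indicator w) (λ j → (M · L) j w) ⟩
      ⟨ L i , indicator w ⟩ - (L · (M · L)) i w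
        ≡⟨ cong₂ _-_ (⟨⟩-indicatorʳ (L i) w) (trans (·-assoc L M L i w) (LML≡L i w)) ⟩
      L i w - L i w
        ≡⟨ ℚ.+-inverseʳ (L i w) ⟩
      0ℚ ∎
      where open ≡-Reasoning

    L*ᵥ[Mu-Mv]≡incidence : ∀ {u v} → adj G u v ≡ true →
      ∀ w → (L *ᵥ (λ k → M u k - M v k)) w ≡ incidence u v w
    L*ᵥ[Mu-Mv]≡incidence {u} {v} uv w = begin
      ⟨ L w , (λ k → M u k - M v k) ⟩
        ≡⟨ ⟨⟩-distribʳ-- (L w) (M u) (M v) ⟩
      ⟨ L w , M u ⟩ - ⟨ L w , M v ⟩
        ≡⟨ cong₂ _-_ (⟨Lw,Mx⟩≡[ML]xw M u w) (⟨Lw,Mx⟩≡[ML]xw M v w) ⟩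
      P u w - P v w
        ≡⟨ solve 4 (λ a c p q → p :- q := (a :- c) :+ ((c :- q) :- (a :- p))) refl
                   (indicator w u) (indicator w v) (P u w) (P v w) ⟩
      (indicator w u - indicator w v) + ((indicator w v - P v w) - (indicator w u - P u w))
        ≡⟨ cong (λ t → (indicator w u - indicator w v) + ((indicator w v - P v w) - t))
                (L*ᵥy≡0⇒yu≡yv uv (L*ᵥ[1w-MLw]≡0 w)) ⟩
      (indicator w u - indicator w v) + ((indicator w v - P v w) - (indicator w v - P v w))
        ≡⟨ solve 2 (λ x y → x :+ (y :- y) := x) refl (indicator w u - indicator w v) (indicator w v - P v w) ⟩
      indicator w u - indicator w v
        ≡⟨ cong₂ _-_ (indicator-sym w u) (indicator-sym w v) ⟩
      incidence u v w ∎
      where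
      open ≡-Reasoning
      P = M · L

    dipole-energy : ∀ {u v} → adj G u v ≡ true → ∀ p q →
      ⟨ dipole u v p q , L *ᵥ dipole u v p q ⟩ ≡ p * (p * d u + q) + q * (p + q * d v)
    dipole-energy {u} {v} uv p q = begin
      ⟨ x , L *ᵥ x ⟩
        ≡⟨ ⟨⟩-comm x (L *ᵥ x) ⟩
      ⟨ L *ᵥ x , x ⟩
        ≡⟨ ⟨⟩-dipoleʳ (L *ᵥ x) u v p q ⟩
      p * ⟨ L u , x ⟩ - q * ⟨ L v , x ⟩
        ≡⟨ cong₂ (λ a b → p * a - q * b) (⟨⟩-dipoleʳ (L u) u v p q) (⟨⟩-dipoleʳ (L v) u v p q) ⟩
      p * (p * L u u - q * L u v) - q * (p * L v u - q * L v v)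
        ≡⟨ cong₂ (λ a b → p * (p * a - q * L u v) - q * (p * L v u - q * b)) (L-diag u) (L-diag v) ⟩
      p * (p * d u - q * L u v) - q * (p * L v u - q * d v)
        ≡⟨ cong₂ (λ a b → p * (p * d u - q * a) - q * (p * b - q * d v))
                 (L-adj uv) (L-adj (trans (symmetric G v u) uv)) ⟩
      p * (p * d u - q * - 1ℚ) - q * (p * - 1ℚ - q * d v)
        ≡⟨ solve 4 (λ p q a c → p :* (p :* a :- q :* con (- 1ℚ)) :- q :* (p :* con (- 1ℚ) :- q :* c)
                              := p :* (p :* a :+ q) :+ q :* (p :+ q :* c)) refl p q (d u) (d v) ⟩
      p * (p * d u + q) + q * (p + q * d v) ∎
      where
      open ≡-Reasoning
      x = dipole u v p q

    dipoleBound≤effRes : ∀ {u v} → adj G u v ≡ true → ∀ p q → dipoleBound (d u) (d v) p q ≤ effRes M u v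
    dipoleBound≤effRes {u} {v} uv p q = begin
      dipoleBound (d u) (d v) p q
        ≡⟨ cong₂ (λ s e → s + s - e) (⟨dipole,incidence⟩ (adj⇒≢ uv) p q) (dipole-energy uv p q) ⟨
      ⟨ x , incidence u v ⟩ + ⟨ x , incidence u v ⟩ - ⟨ x , L *ᵥ x ⟩
        ≤⟨ 2⟨x,b⟩-⟨x,Lx⟩≤⟨z,b⟩ L-sym L-psd (L*ᵥ[Mu-Mv]≡incidence uv) x ⟩
      ⟨ (λ k → M u k - M v k) , incidence u v ⟩
        ≡⟨ effRes≡⟨rowDifference,incidence⟩ M u v ⟨
      effRes M u v ∎
      where
      open ℚ.≤-Reasoning
      x = dipole u v p q

theorem3p9 : ∀ {n} (G : SimpleGraph n) (u v : Fin n) →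
    adj G u v ≡ true →
    (degree G u ≥ 2 ⊎ degree G v ≥ 2) →
    (M : Matrix n) → IsPseudoInverse (laplacian G) M →
    (((degree G v Data.Nat.+ degree G u) ∸ 2) ÷ℕ ((degree G u Data.Nat.* degree G v) ∸ 1))
      ⊔ (4 ÷ℕ (degree G u Data.Nat.+ degree G v Data.Nat.+ 2))
      ≤ effRes M u v
theorem3p9 G u v uv 2≤du⊎2≤dv M (LML≡L , _) =
  ℚ.⊔-lub ([du+dv-2]/[du*dv-1]≤ du dv bound 1≤du 1≤dv (2≤m*n 1≤du 1≤dv 2≤du⊎2≤dv))
          (4/[du+dv+2]≤ du dv bound)
  where
  open Laplacian G
  du = degree G u
  dv = degree G v
  1≤du = adj⇒1≤degree uv
  1≤dv = adj⇒1≤degree (trans (symmetric G v u) uv)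
  bound = dipoleBound≤effRes LML≡L uv
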